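{- For all integers $n,p\geq 1$, \[ \{\phi_n,\phi_p\}=\sum_{k=1}^{\max(n-1,p-1)}\left(\binom{n+p-1-k}{n-k}-\binom{n+p-1-k}{p-k}\right)[\phi_k,\phi_{n+p-k}], \] where a binomial coefficient $\binom{m}{j}$ with $j<0$ is taken to be $0$.
   Context: Let $\mathcal L$ be the free Lie algebra over $\mathbb Q$ on two generators $a,b$, with Lie bracket $[\cdot,\cdot]$, and let $\mathrm{ad}_a(x)=[a,x]$. For $n\geq 1$ set $\phi_n=\frac{1}{(n-1)!}\mathrm{ad}_a^{\,n-1}(b)$. For $f\in\mathcal L$, $D_f$ denotes the unique derivation of $\mathcal L$ with $D_f(a)=[f,a]$ and $D_f(b)=0$. The Ihara bracket of $f,g\in\mathcal L$ is $\{f,g\}=[f,g]+D_g(f)-D_f(g)$. -}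

module Defs where

open import Data.Bool using (if_then_else_)
open import Data.Nat as ℕ using (ℕ; zero; suc; _∸_; _≤ᵇ_; _!)
open import Data.Nat.Properties using (_!≢0)
open import Data.Nat.Combinatorics using (_C_)
open import Data.Integer using (+_)
open import Data.Rational using (ℚ; 0ℚ; 1ℚ; _+_; _*_; -_; _/_)
open import Data.List using (List; []; _∷_; _++_; map; concatMap; foldr)
open import Data.List.Properties using (≡-dec)
open import Data.Product using (_×_; _,_)
open import Relation.Binary.PropositionalEquality using (_≡_)
open import Relation.Binary.Definitions using (DecidableEquality)
open import Relation.Nullary using (yes; no)

-- The free associative algebra ℚ⟨a,b⟩ (tensor algebra on two letters).
-- The free Lie algebra 𝓛 on a,b is realised as the Lie subalgebra of
-- ℚ⟨a,b⟩ (with commutator bracket) generated by a and b (Lie polynomials).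

data Gen : Set where
  A B : Gen

_≟G_ : DecidableEquality Gen
A ≟G A = yes _≡_.refl
A ≟G B = no λ ()
B ≟G A = no λ ()
B ≟G B = yes _≡_.refl

Word : Set
Word = List Gen

_≟W_ : DecidableEquality Word
_≟W_ = ≡-dec _≟G_

Poly : Set
Poly = List (ℚ × Word)

coeff : Poly → Word → ℚ
coeff [] w = 0ℚ
coeff ((c , u) ∷ p) w with u ≟W w
... | yes _ = c + coeff p w
... | no  _ = coeff p w

infix 4 _≈_
_≈_ : Poly → Poly → Set
p ≈ q = ∀ w → coeff p w ≡ coeff q w

zeroP : Poly
zeroP = []

gen : Gen → Poly
gen x = (1ℚ , x ∷ []) ∷ []

aP bP : Poly
aP = gen A
bP = gen B

infixl 6 _⊕_ _⊖_
_⊕_ : Poly → Poly → Poly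
p ⊕ q = p ++ q

scale : ℚ → Poly → Poly
scale c = map (λ { (d , w) → (c * d , w) })

_⊖_ : Poly → Poly → Poly
p ⊖ q = p ⊕ scale (- 1ℚ) q

infixl 7 _⊗_
_⊗_ : Poly → Poly → Poly
p ⊗ q = concatMap (λ { (c , u) → map (λ { (d , v) → (c * d , u ++ v) }) q }) p

⟦_,_⟧ : Poly → Poly → Poly
⟦ p , q ⟧ = p ⊗ q ⊖ q ⊗ p

ad-a : Poly → Poly
ad-a x = ⟦ aP , x ⟧

iter : ℕ → (Poly → Poly) → Poly → Poly
iter zero    f x = x
iter (suc k) f x = f (iter k f x)

-- φ_n = (1/(n-1)!) ad_a^{n-1}(b) for n ≥ 1  (φ 0 is a dummy, never used)
φ : ℕ → Poly
φ zero    = zeroP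
φ (suc m) = scale ((+ 1 / (m !)) {{m !≢0}}) (iter m ad-a bP)

-- D_f : the derivation with D_f(a) = [f,a], D_f(b) = 0.
-- On ℚ⟨a,b⟩ this is the unique derivation with these values on the letters;
-- it preserves Lie polynomials and restricts to D_f on 𝓛.
δ : Poly → Gen → Poly
δ f A = ⟦ f , aP ⟧
δ f B = zeroP

Dword : Poly → Word → Poly
Dword f []      = zeroP
Dword f (x ∷ w) = δ f x ⊗ ((1ℚ , w) ∷ []) ⊕ ((1ℚ , x ∷ []) ∷ []) ⊗ Dword f w

D : Poly → Poly → Poly
D f p = concatMap (λ { (c , w) → scale c (Dword f w) }) p

ihara : Poly → Poly → Poly
ihara f g = ⟦ f , g ⟧ ⊕ D g f ⊖ D f g

-- binomial with the convention C(m, j) = 0 for j < 0, where j = n - k: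
-- binom-diff m n k = C(m, n - k) if k ≤ n, else 0
binomShift : ℕ → ℕ → ℕ → ℚ
binomShift m n k = if k ≤ᵇ n then (+ (m C (n ∸ k))) / 1 else 0ℚ

sumFrom1 : ℕ → (ℕ → Poly) → Poly
sumFrom1 zero    t = zeroP
sumFrom1 (suc M) t = sumFrom1 M t ⊕ t (suc M)

-- Write Φ m = ad_a^m b, so that φ (m + 1) = Φ m / m!. As D_f is a derivation with
-- D_f a = [f, a] and D_f b = 0, and ad_a is a derivation of the bracket, induction
-- on m with Pascal's rule gives
--   D_{Φ q} (Φ m) = Σ_{y<m} C(m, y) [Φ y, Φ (m+q-y)].
-- So {Φ m, Φ q} = [Φ m, Φ q] + Σ_{y<m} C(m,y) [..] - Σ_{y<q} C(q,y) [..], and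
-- extending both sums to y < max(m, q) absorbs [Φ m, Φ q]: the one new term is
-- [Φ m, Φ q] if m < q, -[Φ q, Φ m] = [Φ m, Φ q] if q < m, while [Φ m, Φ m] = 0.
-- Dividing by m! q! gives the statement, since
--   C(m+q-y, m-y) m! q! = C(m, y) y! (m+q-y)!.

module Submission where

open import Defs
open import Data.Nat using (ℕ; _≤_; _+_; _∸_; _⊔_)
open import Data.Rational using (_-_)

open import Data.Bool as Bool using (true; false; if_then_else_)
open import Data.Bool.Properties using (T-≡)
open import Data.Integer as ℤ using (+_)
import Data.Integer.Properties as ℤₚ
open import Data.List using ([]; _∷_; _++_; map; concatMap; filter; length)
open import Data.List.Properties using (++-assoc; ++-identityʳ; map-++; length-filter; filter-reject)
open import Data.Nat as ℕ using (zero; suc; s≤s; z≤n; _<_; _!)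
open import Data.Nat.Combinatorics
  using (_C_; nCn≡1; k>n⇒nCk≡0; nCk+nC[k+1]≡[n+1]C[k+1]; nCk≡n!/k![n-k]!; k![n∸k]!∣n!)
open import Data.Nat.DivMod using (m/n*n≡m)
open import Data.Nat.Properties using (_!≢0; _!*_!≢0)
import Data.Nat.Properties as ℕₚ
open import Data.Nat.Tactic.RingSolver using (solve-∀)
open import Data.Product using (_,_; proj₁; proj₂)
open import Data.Rational as ℚ using (ℚ; 0ℚ; 1ℚ; _/_)
import Data.Rational.Properties as ℚₚ
open import Data.Rational.Solver using (module +-*-Solver)
open +-*-Solver using (solve; _:+_; _:*_; :-_; _:=_; con)
import Data.Rational.Unnormalised as ℚᵘ
import Data.Rational.Unnormalised.Properties as ℚᵘₚ
open import Data.Sum using ([_,_]′)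
open import Function using (_∘_; Equivalence)
open import Relation.Binary.Bundles using (Setoid)
open import Relation.Binary.Definitions using (tri<; tri≈; tri>)
open import Relation.Binary.PropositionalEquality
  using (_≡_; _≢_; refl; sym; trans; cong; cong₂; subst; module ≡-Reasoning)
import Relation.Binary.Reasoning.Setoid as SetoidReasoning
open import Relation.Nullary using (¬_; yes; no; ¬?; contradiction)

-1ℚ : ℚ
-1ℚ = ℚ.- 1ℚ

mono : Word → Poly
mono u = (1ℚ , u) ∷ []

coeff-∷ : ∀ c u p w → coeff ((c , u) ∷ p) w ≡ c ℚ.* coeff (mono u) w ℚ.+ coeff p w
coeff-∷ c u p w with u ≟W w
... | yes _ = cong (ℚ._+ coeff p w) (sym (ℚₚ.*-identityʳ c))
... | no _  = sym (trans (cong (ℚ._+ coeff p w) (ℚₚ.*-zeroʳ c)) (ℚₚ.+-identityˡ _))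

linFun : (Word → ℚ) → Poly → ℚ
linFun h []            = 0ℚ
linFun h ((c , u) ∷ p) = c ℚ.* h u ℚ.+ linFun h p

coeff-as-linFun : ∀ p w → coeff p w ≡ linFun (λ u → coeff (mono u) w) p
coeff-as-linFun []            w = refl
coeff-as-linFun ((c , u) ∷ p) w =
  trans (coeff-∷ c u p w) (cong (c ℚ.* coeff (mono u) w ℚ.+_) (coeff-as-linFun p w))

linFun-++ : ∀ h p q → linFun h (p ++ q) ≡ linFun h p ℚ.+ linFun h q
linFun-++ h []            q = sym (ℚₚ.+-identityˡ _)
linFun-++ h ((c , u) ∷ p) q = trans (cong (c ℚ.* h u ℚ.+_) (linFun-++ h p q))
  (sym (ℚₚ.+-assoc (c ℚ.* h u) (linFun h p) (linFun h q)))

linFun-scale : ∀ h c p → linFun h (scale c p) ≡ c ℚ.* linFun h p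
linFun-scale h c []            = sym (ℚₚ.*-zeroʳ c)
linFun-scale h c ((d , u) ∷ p) = trans (cong ((c ℚ.* d) ℚ.* h u ℚ.+_) (linFun-scale h c p))
  (solve 4 (λ c d x y → (c :* d) :* x :+ c :* y := c :* (d :* x :+ y)) refl c d (h u) (linFun h p))

linFun-congʰ : ∀ {h h'} p → (∀ u → h u ≡ h' u) → linFun h p ≡ linFun h' p
linFun-congʰ []            eq = refl
linFun-congʰ ((c , u) ∷ p) eq = cong₂ (λ x y → c ℚ.* x ℚ.+ y) (eq u) (linFun-congʰ p eq)

linFun-+ʰ : ∀ h h' p → linFun (λ u → h u ℚ.+ h' u) p ≡ linFun h p ℚ.+ linFun h' p
linFun-+ʰ h h' []            = refl
linFun-+ʰ h h' ((c , u) ∷ p) = trans (cong (c ℚ.* (h u ℚ.+ h' u) ℚ.+_) (linFun-+ʰ h h' p))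
  (solve 5 (λ c x x' y y' → c :* (x :+ x') :+ (y :+ y') := (c :* x :+ y) :+ (c :* x' :+ y')) refl
     c (h u) (h' u) (linFun h p) (linFun h' p))

linFun-scaleʰ : ∀ d h p → linFun (λ u → d ℚ.* h u) p ≡ d ℚ.* linFun h p
linFun-scaleʰ d h []            = sym (ℚₚ.*-zeroʳ d)
linFun-scaleʰ d h ((c , u) ∷ p) = trans (cong (c ℚ.* (d ℚ.* h u) ℚ.+_) (linFun-scaleʰ d h p))
  (solve 4 (λ c d x y → c :* (d :* x) :+ d :* y := d :* (c :* x :+ y)) refl c d (h u) (linFun h p))

coeff-⊕ : ∀ p q w → coeff (p ⊕ q) w ≡ coeff p w ℚ.+ coeff q w
coeff-⊕ p q w = begin
  coeff (p ++ q) w                      ≡⟨ coeff-as-linFun (p ++ q) w ⟩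
  linFun _ (p ++ q)                     ≡⟨ linFun-++ _ p q ⟩
  linFun _ p ℚ.+ linFun _ q             ≡⟨ sym (cong₂ ℚ._+_ (coeff-as-linFun p w) (coeff-as-linFun q w)) ⟩
  coeff p w ℚ.+ coeff q w               ∎
  where open ≡-Reasoning

coeff-scale : ∀ c p w → coeff (scale c p) w ≡ c ℚ.* coeff p w
coeff-scale c p w = begin
  coeff (scale c p) w      ≡⟨ coeff-as-linFun (scale c p) w ⟩
  linFun _ (scale c p)     ≡⟨ linFun-scale _ c p ⟩
  c ℚ.* linFun _ p         ≡⟨ sym (cong (c ℚ.*_) (coeff-as-linFun p w)) ⟩
  c ℚ.* coeff p w          ∎
  where open ≡-Reasoning

-- _≈_ is a Π-type, from which Agda cannot infer the two polynomials;
-- the record wrapper makes them inferable.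
infix 4 _≃_
record _≃_ (p q : Poly) : Set where
  constructor coeffwise
  field coeff-≡ : p ≈ q
open _≃_ public

≃-setoid : Setoid _ _
≃-setoid = record
  { Carrier       = Poly
  ; _≈_           = _≃_
  ; isEquivalence = record
    { refl  = coeffwise λ w → refl
    ; sym   = λ (coeffwise e) → coeffwise λ w → sym (e w)
    ; trans = λ (coeffwise e) (coeffwise e') → coeffwise λ w → trans (e w) (e' w)
    }
  }

open Setoid ≃-setoid public using () renaming (refl to ≃-refl; sym to ≃-sym; trans to ≃-trans; reflexive to ≡⇒≃)

-- Formal ℚ-linear combinations of polynomials: rearranging such a combination
-- is checked coefficientwise, by the ring solver for ℚ.
infixl 6 _⊕ₗ_ _⊖ₗ_
infixr 7 _·ₗ_
data Lin : Set where
  ‵_   : Poly → Lin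
  _⊕ₗ_ : Lin → Lin → Lin
  _·ₗ_ : ℚ → Lin → Lin

_⊖ₗ_ : Lin → Lin → Lin
e ⊖ₗ e' = e ⊕ₗ -1ℚ ·ₗ e'

⟦_⟧ₗ : Lin → Poly
⟦ ‵ p ⟧ₗ    = p
⟦ e ⊕ₗ e' ⟧ₗ = ⟦ e ⟧ₗ ⊕ ⟦ e' ⟧ₗ
⟦ c ·ₗ e ⟧ₗ  = scale c ⟦ e ⟧ₗ

coeffₗ : Lin → Word → ℚ
coeffₗ (‵ p)     w = coeff p w
coeffₗ (e ⊕ₗ e') w = coeffₗ e w ℚ.+ coeffₗ e' w
coeffₗ (c ·ₗ e)  w = c ℚ.* coeffₗ e w

coeff-⟦⟧ₗ : ∀ e w → coeff ⟦ e ⟧ₗ w ≡ coeffₗ e w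
coeff-⟦⟧ₗ (‵ p)     w = refl
coeff-⟦⟧ₗ (e ⊕ₗ e') w =
  trans (coeff-⊕ ⟦ e ⟧ₗ ⟦ e' ⟧ₗ w) (cong₂ ℚ._+_ (coeff-⟦⟧ₗ e w) (coeff-⟦⟧ₗ e' w))
coeff-⟦⟧ₗ (c ·ₗ e)  w = trans (coeff-scale c ⟦ e ⟧ₗ w) (cong (c ℚ.*_) (coeff-⟦⟧ₗ e w))

by-coeffs : ∀ e e' → (∀ w → coeffₗ e w ≡ coeffₗ e' w) → ⟦ e ⟧ₗ ≃ ⟦ e' ⟧ₗ
by-coeffs e e' eq = coeffwise λ w → trans (coeff-⟦⟧ₗ e w) (trans (eq w) (sym (coeff-⟦⟧ₗ e' w)))

⊕-cong : ∀ {p p' q q'} → p ≃ p' → q ≃ q' → p ⊕ q ≃ p' ⊕ q'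
⊕-cong {p} {p'} {q} {q'} (coeffwise e) (coeffwise e') = coeffwise λ w →
  trans (coeff-⊕ p q w) (trans (cong₂ ℚ._+_ (e w) (e' w)) (sym (coeff-⊕ p' q' w)))

⊕-congˡ : ∀ p {q q'} → q ≃ q' → p ⊕ q ≃ p ⊕ q'
⊕-congˡ p = ⊕-cong (≃-refl {p})

⊕-congʳ : ∀ q {p p'} → p ≃ p' → p ⊕ q ≃ p' ⊕ q
⊕-congʳ q p≃p' = ⊕-cong p≃p' (≃-refl {q})

scale-cong : ∀ c {p q} → p ≃ q → scale c p ≃ scale c q
scale-cong c {p} {q} (coeffwise e) = coeffwise λ w →
  trans (coeff-scale c p w) (trans (cong (c ℚ.*_) (e w)) (sym (coeff-scale c q w)))

scale-congʳ : ∀ {c d} p → c ≡ d → scale c p ≃ scale d p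
scale-congʳ p refl = ≃-refl

⊖-cong : ∀ {p p' q q'} → p ≃ p' → q ≃ q' → p ⊖ q ≃ p' ⊖ q'
⊖-cong p≃p' q≃q' = ⊕-cong p≃p' (scale-cong -1ℚ q≃q')

⊕-assoc : ∀ p q r → (p ⊕ q) ⊕ r ≃ p ⊕ (q ⊕ r)
⊕-assoc p q r = ≡⇒≃ (++-assoc p q r)

⊕-identityʳ : ∀ p → p ⊕ [] ≃ p
⊕-identityʳ p = ≡⇒≃ (++-identityʳ p)

⊕-comm : ∀ p q → p ⊕ q ≃ q ⊕ p
⊕-comm p q = by-coeffs (‵ p ⊕ₗ ‵ q) (‵ q ⊕ₗ ‵ p) λ w → ℚₚ.+-comm (coeff p w) (coeff q w)

⊕-interchange : ∀ p q r s → (p ⊕ q) ⊕ (r ⊕ s) ≃ (p ⊕ r) ⊕ (q ⊕ s)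
⊕-interchange p q r s = by-coeffs ((‵ p ⊕ₗ ‵ q) ⊕ₗ (‵ r ⊕ₗ ‵ s)) ((‵ p ⊕ₗ ‵ r) ⊕ₗ (‵ q ⊕ₗ ‵ s)) λ w →
  solve 4 (λ p q r s → (p :+ q) :+ (r :+ s) := (p :+ r) :+ (q :+ s)) refl
    (coeff p w) (coeff q w) (coeff r w) (coeff s w)

scale-⊕ : ∀ c p q → scale c (p ⊕ q) ≃ scale c p ⊕ scale c q
scale-⊕ c p q = ≡⇒≃ (map-++ _ p q)

scale-⊕-interchange : ∀ c p q r s → scale c (p ⊕ q) ⊕ (r ⊕ s) ≃ (scale c p ⊕ r) ⊕ (scale c q ⊕ s)
scale-⊕-interchange c p q r s =
  ≃-trans (⊕-congʳ (r ⊕ s) (scale-⊕ c p q)) (⊕-interchange (scale c p) (scale c q) r s)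

scale-scale : ∀ c d p → scale c (scale d p) ≃ scale (c ℚ.* d) p
scale-scale c d p = by-coeffs (c ·ₗ d ·ₗ ‵ p) ((c ℚ.* d) ·ₗ ‵ p) λ w → sym (ℚₚ.*-assoc c d (coeff p w))

scale-1 : ∀ p → scale 1ℚ p ≃ p
scale-1 p = by-coeffs (1ℚ ·ₗ ‵ p) (‵ p) λ w → ℚₚ.*-identityˡ (coeff p w)

scale-0 : ∀ p → scale 0ℚ p ≃ []
scale-0 p = by-coeffs (0ℚ ·ₗ ‵ p) (‵ []) λ w → ℚₚ.*-zeroˡ (coeff p w)

scale-+ : ∀ c d p → scale (c ℚ.+ d) p ≃ scale c p ⊕ scale d p
scale-+ c d p = by-coeffs ((c ℚ.+ d) ·ₗ ‵ p) (c ·ₗ ‵ p ⊕ₗ d ·ₗ ‵ p) λ w → ℚₚ.*-distribʳ-+ (coeff p w) c d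

scale-- : ∀ c d p → scale (c - d) p ≃ scale c p ⊖ scale d p
scale-- c d p = by-coeffs ((c - d) ·ₗ ‵ p) (c ·ₗ ‵ p ⊖ₗ d ·ₗ ‵ p) λ w →
  solve 3 (λ c d x → (c :+ (:- d)) :* x := c :* x :+ (:- con 1ℚ) :* (d :* x)) refl c d (coeff p w)

scale-⊖ : ∀ c p q → scale c p ⊖ scale c q ≃ scale c (p ⊖ q)
scale-⊖ c p q = by-coeffs (c ·ₗ ‵ p ⊖ₗ c ·ₗ ‵ q) (c ·ₗ (‵ p ⊖ₗ ‵ q)) λ w →
  solve 3 (λ c a b → c :* a :+ (:- con 1ℚ) :* (c :* b) := c :* (a :+ (:- con 1ℚ) :* b)) refl
    c (coeff p w) (coeff q w)

-- Linear functionals are well defined on equality classes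

coeff-mono-≢ : ∀ {u w} → u ≢ w → coeff (mono u) w ≡ 0ℚ
coeff-mono-≢ {u} {w} u≢w with u ≟W w
... | yes u≡w = contradiction u≡w u≢w
... | no _    = refl

coeff-∷-≢ : ∀ c {u w} p → u ≢ w → coeff ((c , u) ∷ p) w ≡ coeff p w
coeff-∷-≢ c {u} {w} p u≢w = begin
  coeff ((c , u) ∷ p) w                   ≡⟨ coeff-∷ c u p w ⟩
  c ℚ.* coeff (mono u) w ℚ.+ coeff p w    ≡⟨ cong (λ x → c ℚ.* x ℚ.+ coeff p w) (coeff-mono-≢ u≢w) ⟩
  c ℚ.* 0ℚ ℚ.+ coeff p w                  ≡⟨ cong (ℚ._+ coeff p w) (ℚₚ.*-zeroʳ c) ⟩
  0ℚ ℚ.+ coeff p w                        ≡⟨ ℚₚ.+-identityˡ (coeff p w) ⟩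
  coeff p w                               ∎
  where open ≡-Reasoning

dropWord : Word → Poly → Poly
dropWord u = filter (λ t → ¬? (proj₂ t ≟W u))

linFun-dropWord : ∀ h u p → linFun h p ≡ coeff p u ℚ.* h u ℚ.+ linFun h (dropWord u p)
linFun-dropWord h u [] = sym (trans (cong (ℚ._+ 0ℚ) (ℚₚ.*-zeroˡ (h u))) (ℚₚ.+-identityʳ 0ℚ))
linFun-dropWord h u ((c , v) ∷ p) with v ≟W u
... | yes refl = trans (cong (c ℚ.* h v ℚ.+_) (linFun-dropWord h u p))
  (solve 4 (λ c x a y → c :* x :+ (a :* x :+ y) := (c :+ a) :* x :+ y) refl
     c (h v) (coeff p v) (linFun h (dropWord u p)))
... | no _     = trans (cong (c ℚ.* h v ℚ.+_) (linFun-dropWord h u p))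
  (solve 4 (λ cx a x y → cx :+ (a :* x :+ y) := a :* x :+ (cx :+ y)) refl
     (c ℚ.* h v) (coeff p u) (h u) (linFun h (dropWord u p)))

coeff-dropWord-self : ∀ u p → coeff (dropWord u p) u ≡ 0ℚ
coeff-dropWord-self u [] = refl
coeff-dropWord-self u ((c , v) ∷ p) with v ≟W u
... | yes _   = coeff-dropWord-self u p
... | no v≢u = trans (coeff-∷-≢ c (dropWord u p) v≢u) (coeff-dropWord-self u p)

coeff-dropWord-≢ : ∀ {u w} p → u ≢ w → coeff (dropWord u p) w ≡ coeff p w
coeff-dropWord-≢ [] u≢w = refl
coeff-dropWord-≢ {u} {w} ((c , v) ∷ p) u≢w with v ≟W u
... | yes refl = trans (coeff-dropWord-≢ p u≢w) (sym (coeff-∷-≢ c p u≢w))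
... | no _     = begin
  coeff ((c , v) ∷ dropWord u p) w                  ≡⟨ coeff-∷ c v (dropWord u p) w ⟩
  c ℚ.* coeff (mono v) w ℚ.+ coeff (dropWord u p) w ≡⟨ cong (c ℚ.* coeff (mono v) w ℚ.+_) (coeff-dropWord-≢ p u≢w) ⟩
  c ℚ.* coeff (mono v) w ℚ.+ coeff p w              ≡⟨ coeff-∷ c v p w ⟨
  coeff ((c , v) ∷ p) w                             ∎
  where open ≡-Reasoning

dropWord-null : ∀ u {p} → p ≃ [] → dropWord u p ≃ []
dropWord-null u {p} (coeffwise null) = coeffwise vanish
  where
  vanish : ∀ w → coeff (dropWord u p) w ≡ 0ℚ
  vanish w with u ≟W w
  ... | yes refl = coeff-dropWord-self u p
  ... | no u≢w   = trans (coeff-dropWord-≢ p u≢w) (null w)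

-- Peel off all terms carrying the first word at once; their coefficients sum to zero.
linFun-null : ∀ h {p} → p ≃ [] → linFun h p ≡ 0ℚ
linFun-null h {p} = go (length p) p ℕₚ.≤-refl
  where
  go : ∀ n p → length p ≤ n → p ≃ [] → linFun h p ≡ 0ℚ
  go _       []            _         _    = refl
  go (suc n) ((c , u) ∷ p) (s≤s len) null = begin
    linFun h ((c , u) ∷ p)                          ≡⟨ linFun-dropWord h u ((c , u) ∷ p) ⟩
    coeff ((c , u) ∷ p) u ℚ.* h u ℚ.+ linFun h rest
      ≡⟨ cong₂ (λ x y → x ℚ.* h u ℚ.+ y) (coeff-≡ null u) (go n rest shorter (dropWord-null u null)) ⟩
    0ℚ ℚ.* h u ℚ.+ 0ℚ                               ≡⟨ solve 1 (λ x → con 0ℚ :* x :+ con 0ℚ := con 0ℚ) refl (h u) ⟩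
    0ℚ                                              ∎
    where
    open ≡-Reasoning
    rest = dropWord u ((c , u) ∷ p)
    shorter : length rest ≤ n
    shorter = subst (λ r → length r ≤ n) (sym (filter-reject (λ t → ¬? (proj₂ t ≟W u)) (λ u≢u → u≢u refl)))
      (ℕₚ.≤-trans (length-filter (λ t → ¬? (proj₂ t ≟W u)) p) len)

linFun-cong : ∀ h {p q} → p ≃ q → linFun h p ≡ linFun h q
linFun-cong h {p} {q} (coeffwise p≈q) = begin
  linFun h p                                 ≡⟨ solve 2 (λ a b → a := (a :+ (:- con 1ℚ) :* b) :+ b) refl (linFun h p) (linFun h q) ⟩
  linFun h p ℚ.+ -1ℚ ℚ.* linFun h q ℚ.+ linFun h q
    ≡⟨ cong (λ x → linFun h p ℚ.+ x ℚ.+ linFun h q) (linFun-scale h -1ℚ q) ⟨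
  linFun h p ℚ.+ linFun h (scale -1ℚ q) ℚ.+ linFun h q
    ≡⟨ cong (ℚ._+ linFun h q) (linFun-++ h p (scale -1ℚ q)) ⟨
  linFun h (p ⊖ q) ℚ.+ linFun h q            ≡⟨ cong (ℚ._+ linFun h q) (linFun-null h p⊖q≃[]) ⟩
  0ℚ ℚ.+ linFun h q                          ≡⟨ ℚₚ.+-identityˡ (linFun h q) ⟩
  linFun h q                                 ∎
  where
  open ≡-Reasoning
  p⊖q≃[] : p ⊖ q ≃ []
  p⊖q≃[] = by-coeffs (‵ p ⊖ₗ ‵ q) (‵ []) λ w →
    trans (cong (λ x → x ℚ.+ -1ℚ ℚ.* coeff q w) (p≈q w)) (solve 1 (λ x → x :+ (:- con 1ℚ) :* x := con 0ℚ) refl (coeff q w))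

linMap : (Word → Poly) → Poly → Poly
linMap G = concatMap (λ t → scale (proj₁ t) (G (proj₂ t)))

coeff-linMap : ∀ G p w → coeff (linMap G p) w ≡ linFun (λ u → coeff (G u) w) p
coeff-linMap G []            w = refl
coeff-linMap G ((c , u) ∷ p) w = trans (coeff-⊕ (scale c (G u)) (linMap G p) w)
  (cong₂ ℚ._+_ (coeff-scale c (G u) w) (coeff-linMap G p w))

termMul : ℚ → Word → Poly → Poly
termMul c u = map (λ t → (c ℚ.* proj₁ t , u ++ proj₂ t))

linFun-termMul : ∀ h c u q → linFun h (termMul c u q) ≡ c ℚ.* linFun (λ v → h (u ++ v)) q
linFun-termMul h c u []            = sym (ℚₚ.*-zeroʳ c)
linFun-termMul h c u ((d , v) ∷ q) = trans (cong ((c ℚ.* d) ℚ.* h (u ++ v) ℚ.+_) (linFun-termMul h c u q))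
  (solve 4 (λ c d x y → (c :* d) :* x :+ c :* y := c :* (d :* x :+ y)) refl
     c d (h (u ++ v)) (linFun (λ v → h (u ++ v)) q))

linFun-⊗ : ∀ h p q → linFun h (p ⊗ q) ≡ linFun (λ u → linFun (λ v → h (u ++ v)) q) p
linFun-⊗ h []            q = refl
linFun-⊗ h ((c , u) ∷ p) q = trans (linFun-++ h (termMul c u q) (p ⊗ q))
  (cong₂ ℚ._+_ (linFun-termMul h c u q) (linFun-⊗ h p q))

splits : Word → Word → Word → ℚ
splits w u v = coeff (mono (u ++ v)) w

coeff-⊗ : ∀ p q w → coeff (p ⊗ q) w ≡ linFun (λ u → linFun (splits w u) q) p
coeff-⊗ p q w = trans (coeff-as-linFun (p ⊗ q) w) (linFun-⊗ _ p q)

⊗-cong : ∀ {p p' q q'} → p ≃ p' → q ≃ q' → p ⊗ q ≃ p' ⊗ q'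
⊗-cong {p} {p'} {q} {q'} p≃p' q≃q' = coeffwise λ w → begin
  coeff (p ⊗ q) w                                ≡⟨ coeff-⊗ p q w ⟩
  linFun (λ u → linFun (splits w u) q) p         ≡⟨ linFun-congʰ p (λ u → linFun-cong (splits w u) q≃q') ⟩
  linFun (λ u → linFun (splits w u) q') p        ≡⟨ linFun-cong _ p≃p' ⟩
  linFun (λ u → linFun (splits w u) q') p'       ≡⟨ coeff-⊗ p' q' w ⟨
  coeff (p' ⊗ q') w                              ∎
  where open ≡-Reasoning

⊗-congˡ : ∀ p {q q'} → q ≃ q' → p ⊗ q ≃ p ⊗ q'
⊗-congˡ p = ⊗-cong (≃-refl {p})

⊗-congʳ : ∀ q {p p'} → p ≃ p' → p ⊗ q ≃ p' ⊗ q
⊗-congʳ q p≃p' = ⊗-cong p≃p' (≃-refl {q})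

⊗-distribʳ : ∀ p q q' → p ⊗ (q ⊕ q') ≃ p ⊗ q ⊕ p ⊗ q'
⊗-distribʳ p q q' = coeffwise λ w → begin
  coeff (p ⊗ (q ⊕ q')) w                                          ≡⟨ coeff-⊗ p (q ⊕ q') w ⟩
  linFun (λ u → linFun (splits w u) (q ⊕ q')) p                    ≡⟨ linFun-congʰ p (λ u → linFun-++ (splits w u) q q') ⟩
  linFun (λ u → linFun (splits w u) q ℚ.+ linFun (splits w u) q') p ≡⟨ linFun-+ʰ _ _ p ⟩
  linFun (λ u → linFun (splits w u) q) p ℚ.+ linFun (λ u → linFun (splits w u) q') p
    ≡⟨ cong₂ ℚ._+_ (coeff-⊗ p q w) (coeff-⊗ p q' w) ⟨
  coeff (p ⊗ q) w ℚ.+ coeff (p ⊗ q') w                              ≡⟨ coeff-⊕ (p ⊗ q) (p ⊗ q') w ⟨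
  coeff (p ⊗ q ⊕ p ⊗ q') w                                          ∎
  where open ≡-Reasoning

⊗-scaleˡ : ∀ c p q → scale c p ⊗ q ≃ scale c (p ⊗ q)
⊗-scaleˡ c p q = coeffwise λ w → begin
  coeff (scale c p ⊗ q) w   ≡⟨ coeff-⊗ (scale c p) q w ⟩
  linFun _ (scale c p)      ≡⟨ linFun-scale _ c p ⟩
  c ℚ.* linFun _ p          ≡⟨ cong (c ℚ.*_) (coeff-⊗ p q w) ⟨
  c ℚ.* coeff (p ⊗ q) w     ≡⟨ coeff-scale c (p ⊗ q) w ⟨
  coeff (scale c (p ⊗ q)) w ∎
  where open ≡-Reasoning

⊗-scaleʳ : ∀ c p q → p ⊗ scale c q ≃ scale c (p ⊗ q)
⊗-scaleʳ c p q = coeffwise λ w → begin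
  coeff (p ⊗ scale c q) w                            ≡⟨ coeff-⊗ p (scale c q) w ⟩
  linFun (λ u → linFun (splits w u) (scale c q)) p   ≡⟨ linFun-congʰ p (λ u → linFun-scale (splits w u) c q) ⟩
  linFun (λ u → c ℚ.* linFun (splits w u) q) p       ≡⟨ linFun-scaleʰ c _ p ⟩
  c ℚ.* linFun (λ u → linFun (splits w u) q) p       ≡⟨ cong (c ℚ.*_) (coeff-⊗ p q w) ⟨
  c ℚ.* coeff (p ⊗ q) w                              ≡⟨ coeff-scale c (p ⊗ q) w ⟨
  coeff (scale c (p ⊗ q)) w                          ∎
  where open ≡-Reasoning

⊗-distribˡ : ∀ p p' q → (p ⊕ p') ⊗ q ≡ p ⊗ q ⊕ p' ⊗ q
⊗-distribˡ []            p' q = refl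
⊗-distribˡ ((c , u) ∷ p) p' q = trans (cong (termMul c u q ++_) (⊗-distribˡ p p' q))
  (sym (++-assoc (termMul c u q) (p ⊗ q) (p' ⊗ q)))

termMul-termMul : ∀ c d u v r → termMul c u (termMul d v r) ≡ termMul (c ℚ.* d) (u ++ v) r
termMul-termMul c d u v []            = refl
termMul-termMul c d u v ((e , w) ∷ r) =
  cong₂ _∷_ (cong₂ _,_ (sym (ℚₚ.*-assoc c d e)) (sym (++-assoc u v w))) (termMul-termMul c d u v r)

termMul-⊗ : ∀ c u q r → termMul c u q ⊗ r ≡ termMul c u (q ⊗ r)
termMul-⊗ c u []            r = refl
termMul-⊗ c u ((d , v) ∷ q) r = begin
  termMul (c ℚ.* d) (u ++ v) r ++ termMul c u q ⊗ r
    ≡⟨ cong₂ _++_ (sym (termMul-termMul c d u v r)) (termMul-⊗ c u q r) ⟩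
  termMul c u (termMul d v r) ++ termMul c u (q ⊗ r)   ≡⟨ map-++ _ (termMul d v r) (q ⊗ r) ⟨
  termMul c u (termMul d v r ++ q ⊗ r)                 ∎
  where open ≡-Reasoning

⊗-assoc : ∀ p q r → (p ⊗ q) ⊗ r ≡ p ⊗ (q ⊗ r)
⊗-assoc []            q r = refl
⊗-assoc ((c , u) ∷ p) q r = trans (⊗-distribˡ (termMul c u q) (p ⊗ q) r)
  (cong₂ _++_ (termMul-⊗ c u q r) (⊗-assoc p q r))

⊗-zeroʳ : ∀ p → p ⊗ [] ≡ []
⊗-zeroʳ []      = refl
⊗-zeroʳ (_ ∷ p) = ⊗-zeroʳ p

⊗-identityˡ : ∀ p → mono [] ⊗ p ≡ p
⊗-identityˡ p = trans (++-identityʳ (termMul 1ℚ [] p)) (go p)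
  where
  go : ∀ p → termMul 1ℚ [] p ≡ p
  go []            = refl
  go ((d , v) ∷ p) = cong₂ _∷_ (cong (_, v) (ℚₚ.*-identityˡ d)) (go p)

⊗-identityʳ : ∀ p → p ⊗ mono [] ≡ p
⊗-identityʳ []            = refl
⊗-identityʳ ((c , u) ∷ p) = cong₂ _∷_ (cong₂ _,_ (ℚₚ.*-identityʳ c) (++-identityʳ u)) (⊗-identityʳ p)

termMul-scale : ∀ c d u q → scale c (termMul d u q) ≡ termMul (c ℚ.* d) u q
termMul-scale c d u []            = refl
termMul-scale c d u ((e , v) ∷ q) = cong₂ _∷_ (cong (_, u ++ v) (sym (ℚₚ.*-assoc c d e))) (termMul-scale c d u q)

termMul-as-scale : ∀ c u q → termMul c u q ≡ scale c (mono u ⊗ q)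
termMul-as-scale c u q = begin
  termMul c u q                ≡⟨ cong (λ x → termMul x u q) (ℚₚ.*-identityʳ c) ⟨
  termMul (c ℚ.* 1ℚ) u q       ≡⟨ termMul-scale c 1ℚ u q ⟨
  scale c (termMul 1ℚ u q)     ≡⟨ cong (scale c) (++-identityʳ (termMul 1ℚ u q)) ⟨
  scale c (mono u ⊗ q)         ∎
  where open ≡-Reasoning

singleton-as-scale : ∀ d v → (d , v) ∷ [] ≡ scale d (mono v)
singleton-as-scale d v = cong (λ x → (x , v) ∷ []) (sym (ℚₚ.*-identityʳ d))

bracket-cong : ∀ {x x' y y'} → x ≃ x' → y ≃ y' → ⟦ x , y ⟧ ≃ ⟦ x' , y' ⟧
bracket-cong x≃x' y≃y' = ⊖-cong (⊗-cong x≃x' y≃y') (⊗-cong y≃y' x≃x')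

bracket-congˡ : ∀ x {y y'} → y ≃ y' → ⟦ x , y ⟧ ≃ ⟦ x , y' ⟧
bracket-congˡ x = bracket-cong (≃-refl {x})

bracket-congʳ : ∀ y {x x'} → x ≃ x' → ⟦ x , y ⟧ ≃ ⟦ x' , y ⟧
bracket-congʳ y x≃x' = bracket-cong x≃x' (≃-refl {y})

bracket-antisym : ∀ x y → ⟦ x , y ⟧ ≃ scale -1ℚ ⟦ y , x ⟧
bracket-antisym x y = by-coeffs (‵ (x ⊗ y) ⊖ₗ ‵ (y ⊗ x)) (-1ℚ ·ₗ (‵ (y ⊗ x) ⊖ₗ ‵ (x ⊗ y))) λ w →
  solve 2 (λ a b → a :+ (:- con 1ℚ) :* b := (:- con 1ℚ) :* (b :+ (:- con 1ℚ) :* a)) refl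
    (coeff (x ⊗ y) w) (coeff (y ⊗ x) w)

bracket-self : ∀ x → ⟦ x , x ⟧ ≃ []
bracket-self x = by-coeffs (‵ (x ⊗ x) ⊖ₗ ‵ (x ⊗ x)) (‵ []) λ w →
  solve 1 (λ a → a :+ (:- con 1ℚ) :* a := con 0ℚ) refl (coeff (x ⊗ x) w)

bracket-zeroʳ : ∀ x → ⟦ x , [] ⟧ ≃ []
bracket-zeroʳ x = ≡⇒≃ (trans (++-identityʳ (x ⊗ [])) (⊗-zeroʳ x))

bracket-⊕ʳ : ∀ x y y' → ⟦ x , y ⊕ y' ⟧ ≃ ⟦ x , y ⟧ ⊕ ⟦ x , y' ⟧
bracket-⊕ʳ x y y' = ≃-trans (⊖-cong (⊗-distribʳ x y y') (≡⇒≃ (⊗-distribˡ y y' x)))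
  (by-coeffs ((‵ (x ⊗ y) ⊕ₗ ‵ (x ⊗ y')) ⊖ₗ (‵ (y ⊗ x) ⊕ₗ ‵ (y' ⊗ x)))
             ((‵ (x ⊗ y) ⊖ₗ ‵ (y ⊗ x)) ⊕ₗ (‵ (x ⊗ y') ⊖ₗ ‵ (y' ⊗ x))) λ w →
    solve 4 (λ a b c d → (a :+ b) :+ m1 :* (c :+ d) := (a :+ m1 :* c) :+ (b :+ m1 :* d)) refl
      (coeff (x ⊗ y) w) (coeff (x ⊗ y') w) (coeff (y ⊗ x) w) (coeff (y' ⊗ x) w))
  where m1 = :- con 1ℚ

bracket-scaleˡ : ∀ c x y → ⟦ scale c x , y ⟧ ≃ scale c ⟦ x , y ⟧
bracket-scaleˡ c x y = ≃-trans (⊖-cong (⊗-scaleˡ c x y) (⊗-scaleʳ c y x)) (scale-⊖ c (x ⊗ y) (y ⊗ x))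

bracket-scaleʳ : ∀ c x y → ⟦ x , scale c y ⟧ ≃ scale c ⟦ x , y ⟧
bracket-scaleʳ c x y = ≃-trans (⊖-cong (⊗-scaleʳ c x y) (⊗-scaleˡ c y x)) (scale-⊖ c (x ⊗ y) (y ⊗ x))

bracket-scale : ∀ a b x y → ⟦ scale a x , scale b y ⟧ ≃ scale (a ℚ.* b) ⟦ x , y ⟧
bracket-scale a b x y = ≃-trans (bracket-scaleˡ a x (scale b y))
  (≃-trans (scale-cong a (bracket-scaleʳ b x y)) (scale-scale a b ⟦ x , y ⟧))

⊗-bracketʳ : ∀ x y z → x ⊗ ⟦ y , z ⟧ ≃ x ⊗ (y ⊗ z) ⊖ x ⊗ (z ⊗ y)
⊗-bracketʳ x y z = ≃-trans (⊗-distribʳ x (y ⊗ z) (scale -1ℚ (z ⊗ y)))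
  (⊕-congˡ (x ⊗ (y ⊗ z)) (⊗-scaleʳ -1ℚ x (z ⊗ y)))

⊗-bracketˡ : ∀ x y z → ⟦ x , y ⟧ ⊗ z ≃ x ⊗ (y ⊗ z) ⊖ y ⊗ (x ⊗ z)
⊗-bracketˡ x y z = ≃-trans (≡⇒≃ (⊗-distribˡ (x ⊗ y) (scale -1ℚ (y ⊗ x)) z))
  (⊕-cong (≡⇒≃ (⊗-assoc x y z))
          (≃-trans (⊗-scaleˡ -1ℚ (y ⊗ x) z) (≡⇒≃ (cong (scale -1ℚ) (⊗-assoc y x z)))))

bracket-bracketʳ : ∀ x y z →
  ⟦ x , ⟦ y , z ⟧ ⟧ ≃ (x ⊗ (y ⊗ z) ⊖ x ⊗ (z ⊗ y)) ⊖ (y ⊗ (z ⊗ x) ⊖ z ⊗ (y ⊗ x))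
bracket-bracketʳ x y z = ⊖-cong (⊗-bracketʳ x y z) (⊗-bracketˡ y z x)

bracket-leibniz : ∀ z x y → ⟦ z , ⟦ x , y ⟧ ⟧ ≃ ⟦ ⟦ z , x ⟧ , y ⟧ ⊕ ⟦ x , ⟦ z , y ⟧ ⟧
bracket-leibniz z x y = begin
  ⟦ z , ⟦ x , y ⟧ ⟧
    ≈⟨ bracket-bracketʳ z x y ⟩
  (zxy ⊖ zyx) ⊖ (xyz ⊖ yxz)
    ≈⟨ by-coeffs ((‵ zxy ⊖ₗ ‵ zyx) ⊖ₗ (‵ xyz ⊖ₗ ‵ yxz))
                 (((‵ zxy ⊖ₗ ‵ xzy) ⊖ₗ (‵ yzx ⊖ₗ ‵ yxz)) ⊕ₗ ((‵ xzy ⊖ₗ ‵ xyz) ⊖ₗ (‵ zyx ⊖ₗ ‵ yzx))) (λ w →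
         solve 6 (λ a b c d e f → (a :+ m1 :* b) :+ m1 :* (c :+ m1 :* d)
                               := ((a :+ m1 :* e) :+ m1 :* (f :+ m1 :* d)) :+ ((e :+ m1 :* c) :+ m1 :* (b :+ m1 :* f))) refl
           (coeff zxy w) (coeff zyx w) (coeff xyz w) (coeff yxz w) (coeff xzy w) (coeff yzx w)) ⟩
  ((zxy ⊖ xzy) ⊖ (yzx ⊖ yxz)) ⊕ ((xzy ⊖ xyz) ⊖ (zyx ⊖ yzx))
    ≈⟨ ⊕-cong (⊖-cong (⊗-bracketˡ z x y) (⊗-bracketʳ y z x)) (bracket-bracketʳ x z y) ⟨
  ⟦ ⟦ z , x ⟧ , y ⟧ ⊕ ⟦ x , ⟦ z , y ⟧ ⟧
    ∎
  where
  open SetoidReasoning ≃-setoid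
  m1 = :- con 1ℚ
  zxy = z ⊗ (x ⊗ y)
  zyx = z ⊗ (y ⊗ x)
  xyz = x ⊗ (y ⊗ z)
  yxz = y ⊗ (x ⊗ z)
  xzy = x ⊗ (z ⊗ y)
  yzx = y ⊗ (z ⊗ x)

bracket-flip : ∀ x y z → ⟦ ⟦ x , y ⟧ , z ⟧ ≃ ⟦ z , ⟦ y , x ⟧ ⟧
bracket-flip x y z = begin
  ⟦ ⟦ x , y ⟧ , z ⟧                         ≈⟨ bracket-antisym ⟦ x , y ⟧ z ⟩
  scale -1ℚ ⟦ z , ⟦ x , y ⟧ ⟧               ≈⟨ scale-cong -1ℚ (bracket-congˡ z (bracket-antisym x y)) ⟩
  scale -1ℚ ⟦ z , scale -1ℚ ⟦ y , x ⟧ ⟧     ≈⟨ scale-cong -1ℚ (bracket-scaleʳ -1ℚ z ⟦ y , x ⟧) ⟩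
  scale -1ℚ (scale -1ℚ ⟦ z , ⟦ y , x ⟧ ⟧)   ≈⟨ scale-scale -1ℚ -1ℚ ⟦ z , ⟦ y , x ⟧ ⟧ ⟩
  scale 1ℚ ⟦ z , ⟦ y , x ⟧ ⟧                ≈⟨ scale-1 ⟦ z , ⟦ y , x ⟧ ⟧ ⟩
  ⟦ z , ⟦ y , x ⟧ ⟧                         ∎
  where open SetoidReasoning ≃-setoid

-- The derivations D f

D-⊕ : ∀ f p q → D f (p ⊕ q) ≡ D f p ⊕ D f q
D-⊕ f []            q = refl
D-⊕ f ((c , u) ∷ p) q = trans (cong (scale c (Dword f u) ++_) (D-⊕ f p q))
  (sym (++-assoc (scale c (Dword f u)) (D f p) (D f q)))

D-scale : ∀ f c p → D f (scale c p) ≃ scale c (D f p)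
D-scale f c p = coeffwise λ w → begin
  coeff (D f (scale c p)) w   ≡⟨ coeff-linMap (Dword f) (scale c p) w ⟩
  linFun _ (scale c p)        ≡⟨ linFun-scale _ c p ⟩
  c ℚ.* linFun _ p            ≡⟨ cong (c ℚ.*_) (coeff-linMap (Dword f) p w) ⟨
  c ℚ.* coeff (D f p) w       ≡⟨ coeff-scale c (D f p) w ⟨
  coeff (scale c (D f p)) w   ∎
  where open ≡-Reasoning

δ-scale : ∀ c f x → δ (scale c f) x ≃ scale c (δ f x)
δ-scale c f A = bracket-scaleˡ c f aP
δ-scale c f B = ≃-refl

Dword-scale : ∀ c f u → Dword (scale c f) u ≃ scale c (Dword f u)
Dword-scale c f []      = ≃-refl
Dword-scale c f (x ∷ u) = ≃-trans
  (⊕-cong (≃-trans (⊗-congʳ (mono u) (δ-scale c f x)) (⊗-scaleˡ c (δ f x) (mono u)))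
          (≃-trans (⊗-congˡ (mono (x ∷ [])) (Dword-scale c f u)) (⊗-scaleʳ c (mono (x ∷ [])) (Dword f u))))
  (≃-sym (scale-⊕ c (δ f x ⊗ mono u) (mono (x ∷ []) ⊗ Dword f u)))

D-scaleᶠ : ∀ c f p → D (scale c f) p ≃ scale c (D f p)
D-scaleᶠ c f p = coeffwise λ w → begin
  coeff (D (scale c f) p) w                      ≡⟨ coeff-linMap (Dword (scale c f)) p w ⟩
  linFun (λ u → coeff (Dword (scale c f) u) w) p
    ≡⟨ linFun-congʰ p (λ u → trans (coeff-≡ (Dword-scale c f u) w) (coeff-scale c (Dword f u) w)) ⟩
  linFun (λ u → c ℚ.* coeff (Dword f u) w) p     ≡⟨ linFun-scaleʰ c _ p ⟩
  c ℚ.* linFun (λ u → coeff (Dword f u) w) p     ≡⟨ cong (c ℚ.*_) (coeff-linMap (Dword f) p w) ⟨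
  c ℚ.* coeff (D f p) w                          ≡⟨ coeff-scale c (D f p) w ⟨
  coeff (scale c (D f p)) w                      ∎
  where open ≡-Reasoning

D-mono : ∀ f u → D f (mono u) ≃ Dword f u
D-mono f u = ≃-trans (⊕-identityʳ _) (scale-1 (Dword f u))

Dword-letter : ∀ f x → Dword f (x ∷ []) ≃ δ f x
Dword-letter f x = ≃-trans (⊕-cong (≡⇒≃ (⊗-identityʳ (δ f x))) (≡⇒≃ (⊗-zeroʳ (mono (x ∷ [])))))
  (⊕-identityʳ (δ f x))

D-a : ∀ f → D f aP ≃ ⟦ f , aP ⟧
D-a f = ≃-trans (D-mono f (A ∷ [])) (Dword-letter f A)

D-b : ∀ f → D f bP ≃ []
D-b f = ≃-trans (D-mono f (B ∷ [])) (Dword-letter f B)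

Dword-++ : ∀ f u v → Dword f (u ++ v) ≃ Dword f u ⊗ mono v ⊕ mono u ⊗ Dword f v
Dword-++ f []      v = ≡⇒≃ (sym (⊗-identityˡ (Dword f v)))
Dword-++ f (x ∷ u) v = begin
  δ f x ⊗ mono (u ++ v) ⊕ X ⊗ Dword f (u ++ v)
    ≈⟨ ⊕-congˡ (δ f x ⊗ mono (u ++ v))
         (≃-trans (⊗-congˡ X (Dword-++ f u v)) (⊗-distribʳ X (Dword f u ⊗ mono v) (mono u ⊗ Dword f v))) ⟩
  δ f x ⊗ (mono u ⊗ mono v) ⊕ (X ⊗ (Dword f u ⊗ mono v) ⊕ X ⊗ (mono u ⊗ Dword f v))
    ≈⟨ ≡⇒≃ (cong₂ _⊕_ (sym (⊗-assoc (δ f x) (mono u) (mono v)))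
              (cong₂ _⊕_ (sym (⊗-assoc X (Dword f u) (mono v))) (sym (⊗-assoc X (mono u) (Dword f v))))) ⟩
  (δ f x ⊗ mono u) ⊗ mono v ⊕ ((X ⊗ Dword f u) ⊗ mono v ⊕ mono (x ∷ u) ⊗ Dword f v)
    ≈⟨ ⊕-assoc ((δ f x ⊗ mono u) ⊗ mono v) ((X ⊗ Dword f u) ⊗ mono v) (mono (x ∷ u) ⊗ Dword f v) ⟨
  ((δ f x ⊗ mono u) ⊗ mono v ⊕ (X ⊗ Dword f u) ⊗ mono v) ⊕ mono (x ∷ u) ⊗ Dword f v
    ≈⟨ ≡⇒≃ (cong (_⊕ mono (x ∷ u) ⊗ Dword f v) (sym (⊗-distribˡ (δ f x ⊗ mono u) (X ⊗ Dword f u) (mono v)))) ⟩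
  (δ f x ⊗ mono u ⊕ X ⊗ Dword f u) ⊗ mono v ⊕ mono (x ∷ u) ⊗ Dword f v
    ∎
  where
  open SetoidReasoning ≃-setoid
  X = mono (x ∷ [])

D-mono-⊗ : ∀ f u q → D f (mono u ⊗ q) ≃ Dword f u ⊗ q ⊕ mono u ⊗ D f q
D-mono-⊗ f u []            = ≡⇒≃ (sym (cong (_⊕ []) (⊗-zeroʳ (Dword f u))))
D-mono-⊗ f u ((d , v) ∷ q) = begin
  scale (1ℚ ℚ.* d) (Dword f (u ++ v)) ⊕ D f (mono u ⊗ q)
    ≈⟨ ⊕-cong (≃-trans (scale-congʳ (Dword f (u ++ v)) (ℚₚ.*-identityˡ d)) (scale-cong d (Dword-++ f u v)))
              (D-mono-⊗ f u q) ⟩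
  scale d (Dword f u ⊗ mono v ⊕ mono u ⊗ Dword f v) ⊕ (Dword f u ⊗ q ⊕ mono u ⊗ D f q)
    ≈⟨ scale-⊕-interchange d (Dword f u ⊗ mono v) (mono u ⊗ Dword f v) (Dword f u ⊗ q) (mono u ⊗ D f q) ⟩
  (scale d (Dword f u ⊗ mono v) ⊕ Dword f u ⊗ q) ⊕ (scale d (mono u ⊗ Dword f v) ⊕ mono u ⊗ D f q)
    ≈⟨ ⊕-cong (⊕-congʳ (Dword f u ⊗ q)
                 (≃-trans (⊗-congˡ (Dword f u) (≡⇒≃ (singleton-as-scale d v))) (⊗-scaleʳ d (Dword f u) (mono v))))
              (⊕-congʳ (mono u ⊗ D f q) (⊗-scaleʳ d (mono u) (Dword f v))) ⟨
  (Dword f u ⊗ ((d , v) ∷ []) ⊕ Dword f u ⊗ q) ⊕ (mono u ⊗ scale d (Dword f v) ⊕ mono u ⊗ D f q)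
    ≈⟨ ⊕-cong (⊗-distribʳ (Dword f u) ((d , v) ∷ []) q) (⊗-distribʳ (mono u) (scale d (Dword f v)) (D f q)) ⟨
  Dword f u ⊗ ((d , v) ∷ q) ⊕ mono u ⊗ (scale d (Dword f v) ⊕ D f q)
    ∎
  where open SetoidReasoning ≃-setoid

D-⊗ : ∀ f p q → D f (p ⊗ q) ≃ D f p ⊗ q ⊕ p ⊗ D f q
D-⊗ f []            q = ≃-refl
D-⊗ f ((c , u) ∷ p) q = begin
  D f (termMul c u q ⊕ p ⊗ q)
    ≈⟨ ≡⇒≃ (D-⊕ f (termMul c u q) (p ⊗ q)) ⟩
  D f (termMul c u q) ⊕ D f (p ⊗ q)
    ≈⟨ ⊕-cong (≃-trans (≡⇒≃ (cong (D f) (termMul-as-scale c u q)))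
                       (≃-trans (D-scale f c (mono u ⊗ q)) (scale-cong c (D-mono-⊗ f u q))))
              (D-⊗ f p q) ⟩
  scale c (Dword f u ⊗ q ⊕ mono u ⊗ D f q) ⊕ (D f p ⊗ q ⊕ p ⊗ D f q)
    ≈⟨ scale-⊕-interchange c (Dword f u ⊗ q) (mono u ⊗ D f q) (D f p ⊗ q) (p ⊗ D f q) ⟩
  (scale c (Dword f u ⊗ q) ⊕ D f p ⊗ q) ⊕ (scale c (mono u ⊗ D f q) ⊕ p ⊗ D f q)
    ≈⟨ ⊕-cong (≃-trans (⊕-congʳ (D f p ⊗ q) (≃-sym (⊗-scaleˡ c (Dword f u) q)))
                       (≡⇒≃ (sym (⊗-distribˡ (scale c (Dword f u)) (D f p) q))))
              (⊕-congʳ (p ⊗ D f q) (≡⇒≃ (sym (termMul-as-scale c u (D f q))))) ⟩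
  (scale c (Dword f u) ⊕ D f p) ⊗ q ⊕ (termMul c u (D f q) ⊕ p ⊗ D f q)
    ∎
  where open SetoidReasoning ≃-setoid

D-bracket : ∀ f x y → D f ⟦ x , y ⟧ ≃ ⟦ D f x , y ⟧ ⊕ ⟦ x , D f y ⟧
D-bracket f x y = begin
  D f (x ⊗ y ⊖ y ⊗ x)
    ≈⟨ ≡⇒≃ (D-⊕ f (x ⊗ y) (scale -1ℚ (y ⊗ x))) ⟩
  D f (x ⊗ y) ⊕ D f (scale -1ℚ (y ⊗ x))
    ≈⟨ ⊕-cong (D-⊗ f x y) (≃-trans (D-scale f -1ℚ (y ⊗ x)) (scale-cong -1ℚ (D-⊗ f y x))) ⟩
  (Dx ⊗ y ⊕ x ⊗ Dy) ⊖ (Dy ⊗ x ⊕ y ⊗ Dx)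
    ≈⟨ by-coeffs ((‵ (Dx ⊗ y) ⊕ₗ ‵ (x ⊗ Dy)) ⊖ₗ (‵ (Dy ⊗ x) ⊕ₗ ‵ (y ⊗ Dx)))
                 ((‵ (Dx ⊗ y) ⊖ₗ ‵ (y ⊗ Dx)) ⊕ₗ (‵ (x ⊗ Dy) ⊖ₗ ‵ (Dy ⊗ x))) (λ w →
         solve 4 (λ a b c d → (a :+ b) :+ m1 :* (c :+ d) := (a :+ m1 :* d) :+ (b :+ m1 :* c)) refl
           (coeff (Dx ⊗ y) w) (coeff (x ⊗ Dy) w) (coeff (Dy ⊗ x) w) (coeff (y ⊗ Dx) w)) ⟩
  ⟦ Dx , y ⟧ ⊕ ⟦ x , Dy ⟧
    ∎
  where
  open SetoidReasoning ≃-setoid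
  m1 = :- con 1ℚ
  Dx = D f x
  Dy = D f y

ihara-scale : ∀ c d f g → ihara (scale c f) (scale d g) ≃ scale (c ℚ.* d) (ihara f g)
ihara-scale c d f g = begin
  ⟦ scale c f , scale d g ⟧ ⊕ D (scale d g) (scale c f) ⊖ D (scale c f) (scale d g)
    ≈⟨ ⊖-cong (⊕-cong (bracket-scale c d f g) (≃-trans (D-scaleᶠ d g (scale c f)) (scale-cong d (D-scale g c f))))
              (≃-trans (D-scaleᶠ c f (scale d g)) (scale-cong c (D-scale f d g))) ⟩
  scale (c ℚ.* d) ⟦ f , g ⟧ ⊕ scale d (scale c (D g f)) ⊖ scale c (scale d (D f g))
    ≈⟨ by-coeffs ((c ℚ.* d) ·ₗ ‵ ⟦ f , g ⟧ ⊕ₗ d ·ₗ c ·ₗ ‵ (D g f) ⊖ₗ c ·ₗ d ·ₗ ‵ (D f g))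
                 ((c ℚ.* d) ·ₗ (‵ ⟦ f , g ⟧ ⊕ₗ ‵ (D g f) ⊖ₗ ‵ (D f g))) (λ w →
         solve 5 (λ c d x y z → (c :* d) :* x :+ d :* (c :* y) :+ (:- con 1ℚ) :* (c :* (d :* z))
                             := (c :* d) :* (x :+ y :+ (:- con 1ℚ) :* z)) refl
           c d (coeff ⟦ f , g ⟧ w) (coeff (D g f) w) (coeff (D f g) w)) ⟩
  scale (c ℚ.* d) (ihara f g) ∎
  where open SetoidReasoning ≃-setoid

fromℕ : ℕ → ℚ
fromℕ n = + n / 1

toℚᵘ-fromℕ : ∀ n → ℚ.toℚᵘ (fromℕ n) ℚᵘ.≃ ℚᵘ.mkℚᵘ (+ n) 0
toℚᵘ-fromℕ n = ℚₚ.toℚᵘ-fromℚᵘ (ℚᵘ.mkℚᵘ (+ n) 0)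

fromℕ-+ : ∀ m n → fromℕ (m + n) ≡ fromℕ m ℚ.+ fromℕ n
fromℕ-+ m n = ℚₚ.toℚᵘ-injective (ℚᵘₚ.≃-trans (toℚᵘ-fromℕ (m + n)) (ℚᵘₚ.≃-trans in-ℚᵘ (ℚᵘₚ.≃-sym
  (ℚᵘₚ.≃-trans (ℚₚ.toℚᵘ-homo-+ (fromℕ m) (fromℕ n)) (ℚᵘₚ.+-cong (toℚᵘ-fromℕ m) (toℚᵘ-fromℕ n))))))
  where
  in-ℚᵘ : ℚᵘ.mkℚᵘ (+ (m + n)) 0 ℚᵘ.≃ ℚᵘ.mkℚᵘ (+ m) 0 ℚᵘ.+ ℚᵘ.mkℚᵘ (+ n) 0
  in-ℚᵘ = ℚᵘ.*≡* (cong (ℤ._* + 1)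
    (trans (ℤₚ.pos-+ m n) (sym (cong₂ ℤ._+_ (ℤₚ.*-identityʳ (+ m)) (ℤₚ.*-identityʳ (+ n))))))

fromℕ-* : ∀ m n → fromℕ (m ℕ.* n) ≡ fromℕ m ℚ.* fromℕ n
fromℕ-* m n = ℚₚ.toℚᵘ-injective (ℚᵘₚ.≃-trans (toℚᵘ-fromℕ (m ℕ.* n)) (ℚᵘₚ.≃-trans in-ℚᵘ (ℚᵘₚ.≃-sym
  (ℚᵘₚ.≃-trans (ℚₚ.toℚᵘ-homo-* (fromℕ m) (fromℕ n)) (ℚᵘₚ.*-cong (toℚᵘ-fromℕ m) (toℚᵘ-fromℕ n))))))
  where
  in-ℚᵘ : ℚᵘ.mkℚᵘ (+ (m ℕ.* n)) 0 ℚᵘ.≃ ℚᵘ.mkℚᵘ (+ m) 0 ℚᵘ.* ℚᵘ.mkℚᵘ (+ n) 0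
  in-ℚᵘ = ℚᵘ.*≡* (cong (ℤ._* + 1) (ℤₚ.pos-* m n))

fromℕ-*-* : ∀ a b c → fromℕ (a ℕ.* (b ℕ.* c)) ≡ fromℕ a ℚ.* (fromℕ b ℚ.* fromℕ c)
fromℕ-*-* a b c = trans (fromℕ-* a (b ℕ.* c)) (cong (fromℕ a ℚ.*_) (fromℕ-* b c))

fromℕ-*-recip : ∀ n .{{_ : ℕ.NonZero n}} → fromℕ n ℚ.* (+ 1 / n) ≡ 1ℚ
fromℕ-*-recip (suc n) = ℚₚ.toℚᵘ-injective (ℚᵘₚ.≃-trans (ℚₚ.toℚᵘ-homo-* (fromℕ (suc n)) (+ 1 / suc n))
  (ℚᵘₚ.≃-trans (ℚᵘₚ.*-cong (toℚᵘ-fromℕ (suc n)) (ℚₚ.toℚᵘ-fromℚᵘ (ℚᵘ.mkℚᵘ (+ 1) n))) in-ℚᵘ))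
  where
  in-ℚᵘ : ℚᵘ.mkℚᵘ (+ suc n) 0 ℚᵘ.* ℚᵘ.mkℚᵘ (+ 1) n ℚᵘ.≃ ℚᵘ.mkℚᵘ (+ 1) 0
  in-ℚᵘ = ℚᵘ.*≡* (trans (ℤₚ.*-identityʳ _) (trans (ℤₚ.*-identityʳ (+ suc n))
    (sym (trans (ℤₚ.*-identityˡ _) (cong (λ k → + suc k) (ℕₚ.+-identityʳ n))))))

fromℕ-pascal : ∀ m y → fromℕ (suc m C suc y) ≡ fromℕ (m C y) ℚ.+ fromℕ (m C suc y)
fromℕ-pascal m y = trans (cong fromℕ (sym (nCk+nC[k+1]≡[n+1]C[k+1] m y))) (fromℕ-+ (m C y) (m C suc y))

fact⁻¹ : ℕ → ℚ
fact⁻¹ m = (+ 1 / m !) {{m !≢0}}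

fact-*-fact⁻¹ : ∀ m → fromℕ (m !) ℚ.* fact⁻¹ m ≡ 1ℚ
fact-*-fact⁻¹ m = fromℕ-*-recip (m !) {{m !≢0}}

*-inverse-pair : ∀ a b a' b' → a ℚ.* a' ≡ 1ℚ → b ℚ.* b' ≡ 1ℚ → (a ℚ.* b) ℚ.* (a' ℚ.* b') ≡ 1ℚ
*-inverse-pair a b a' b' aa'≡1 bb'≡1 = begin
  (a ℚ.* b) ℚ.* (a' ℚ.* b')   ≡⟨ solve 4 (λ a b a' b' → (a :* b) :* (a' :* b') := (a :* a') :* (b :* b')) refl a b a' b' ⟩
  (a ℚ.* a') ℚ.* (b ℚ.* b')   ≡⟨ cong₂ ℚ._*_ aa'≡1 bb'≡1 ⟩
  1ℚ ℚ.* 1ℚ                   ≡⟨ ℚₚ.*-identityˡ 1ℚ ⟩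
  1ℚ                          ∎
  where open ≡-Reasoning

factorials-*-fact⁻¹ : ∀ m q → (fromℕ (m !) ℚ.* fromℕ (q !)) ℚ.* (fact⁻¹ m ℚ.* fact⁻¹ q) ≡ 1ℚ
factorials-*-fact⁻¹ m q =
  *-inverse-pair (fromℕ (m !)) (fromℕ (q !)) (fact⁻¹ m) (fact⁻¹ q) (fact-*-fact⁻¹ m) (fact-*-fact⁻¹ q)

cross-multiply : ∀ a b u v u' v' → u ℚ.* u' ≡ 1ℚ → v ℚ.* v' ≡ 1ℚ →
  a ℚ.* v ≡ b ℚ.* u → a ℚ.* u' ≡ b ℚ.* v'
cross-multiply a b u v u' v' uu'≡1 vv'≡1 av≡bu = begin
  a ℚ.* u'                          ≡⟨ ℚₚ.*-identityʳ (a ℚ.* u') ⟨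
  (a ℚ.* u') ℚ.* 1ℚ                 ≡⟨ cong ((a ℚ.* u') ℚ.*_) vv'≡1 ⟨
  (a ℚ.* u') ℚ.* (v ℚ.* v')         ≡⟨ solve 4 (λ a u' v v' → (a :* u') :* (v :* v') := ((a :* v) :* u') :* v') refl a u' v v' ⟩
  ((a ℚ.* v) ℚ.* u') ℚ.* v'         ≡⟨ cong (λ t → (t ℚ.* u') ℚ.* v') av≡bu ⟩
  ((b ℚ.* u) ℚ.* u') ℚ.* v'         ≡⟨ solve 4 (λ b u u' v' → ((b :* u) :* u') :* v' := b :* ((u :* u') :* v')) refl b u u' v' ⟩
  b ℚ.* ((u ℚ.* u') ℚ.* v')         ≡⟨ cong (λ t → b ℚ.* (t ℚ.* v')) uu'≡1 ⟩
  b ℚ.* (1ℚ ℚ.* v')                 ≡⟨ cong (b ℚ.*_) (ℚₚ.*-identityˡ v') ⟩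
  b ℚ.* v'                          ∎
  where open ≡-Reasoning

C-*-factorials : ∀ {n k} → k ≤ n → (n C k) ℕ.* (k ! ℕ.* (n ∸ k) !) ≡ n !
C-*-factorials {n} {k} k≤n = trans (cong (ℕ._* (k ! ℕ.* (n ∸ k) !)) (nCk≡n!/k![n-k]! k≤n))
  (m/n*n≡m {{k !* (n ∸ k) !≢0}} (k![n∸k]!∣n! k≤n))

binomial-factorial-identity : ∀ m q x → x ≤ m →
  ((m + q ∸ x) C (m ∸ x)) ℕ.* (m ! ℕ.* q !) ≡ (m C x) ℕ.* (x ! ℕ.* (m + q ∸ x) !)
binomial-factorial-identity m q x x≤m = begin
  (n C k) ℕ.* (m ! ℕ.* q !)                           ≡⟨ cong (λ t → (n C k) ℕ.* (t ℕ.* q !)) (C-*-factorials x≤m) ⟨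
  (n C k) ℕ.* (((m C x) ℕ.* (x ! ℕ.* k !)) ℕ.* q !)   ≡⟨ rearrange (n C k) (m C x) (x !) (k !) (q !) ⟩
  (m C x) ℕ.* (x ! ℕ.* ((n C k) ℕ.* (k ! ℕ.* q !)))   ≡⟨ cong (λ t → (m C x) ℕ.* (x ! ℕ.* t)) nCk-factorials ⟩
  (m C x) ℕ.* (x ! ℕ.* n !)                           ∎
  where
  open ≡-Reasoning
  n = m + q ∸ x
  k = m ∸ x
  n∸k≡q : n ∸ k ≡ q
  n∸k≡q = trans (cong (_∸ k) (ℕₚ.+-∸-comm q x≤m)) (ℕₚ.m+n∸m≡n k q)
  nCk-factorials : (n C k) ℕ.* (k ! ℕ.* q !) ≡ n !
  nCk-factorials = trans (cong (λ r → (n C k) ℕ.* (k ! ℕ.* r !)) (sym n∸k≡q))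
    (C-*-factorials (ℕₚ.∸-monoˡ-≤ x (ℕₚ.m≤m+n m q)))
  rearrange : ∀ a b c d e → a ℕ.* ((b ℕ.* (c ℕ.* d)) ℕ.* e) ≡ b ℕ.* (c ℕ.* (a ℕ.* (d ℕ.* e)))
  rearrange = solve-∀

∑ : ℕ → (ℕ → Poly) → Poly
∑ zero    F = []
∑ (suc L) F = ∑ L F ⊕ F L

∑-cong : ∀ L {F G} → (∀ y → y < L → F y ≃ G y) → ∑ L F ≃ ∑ L G
∑-cong zero    F≃G = ≃-refl
∑-cong (suc L) F≃G = ⊕-cong (∑-cong L (λ y y<L → F≃G y (ℕₚ.m≤n⇒m≤1+n y<L))) (F≃G L ℕₚ.≤-refl)

∑-⊕ : ∀ L F G → ∑ L (λ y → F y ⊕ G y) ≃ ∑ L F ⊕ ∑ L G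
∑-⊕ zero    F G = ≃-refl
∑-⊕ (suc L) F G = ≃-trans (⊕-congʳ (F L ⊕ G L) (∑-⊕ L F G)) (⊕-interchange (∑ L F) (∑ L G) (F L) (G L))

∑-scale : ∀ L c F → ∑ L (λ y → scale c (F y)) ≃ scale c (∑ L F)
∑-scale zero    c F = ≃-refl
∑-scale (suc L) c F = ≃-trans (⊕-congʳ (scale c (F L)) (∑-scale L c F)) (≃-sym (scale-⊕ c (∑ L F) (F L)))

∑-⊖ : ∀ L F G → ∑ L (λ y → F y ⊖ G y) ≃ ∑ L F ⊖ ∑ L G
∑-⊖ L F G = ≃-trans (∑-⊕ L F (λ y → scale -1ℚ (G y))) (⊕-congˡ (∑ L F) (∑-scale L -1ℚ G))

∑-shift : ∀ L F → ∑ (suc L) F ≃ F 0 ⊕ ∑ L (λ y → F (suc y))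
∑-shift zero    F = ⊕-comm [] (F 0)
∑-shift (suc L) F = ≃-trans (⊕-congʳ (F (suc L)) (∑-shift L F)) (⊕-assoc (F 0) (∑ L (λ y → F (suc y))) (F (suc L)))

∑-null-tail : ∀ k L F → (∀ y → L ≤ y → F y ≃ []) → ∑ (k + L) F ≃ ∑ L F
∑-null-tail zero    L F null = ≃-refl
∑-null-tail (suc k) L F null = ≃-trans (⊕-cong (∑-null-tail k L F null) (null (k + L) (ℕₚ.m≤n+m L k))) (⊕-identityʳ (∑ L F))

bracket-∑ʳ : ∀ z L F → ⟦ z , ∑ L F ⟧ ≃ ∑ L (λ y → ⟦ z , F y ⟧)
bracket-∑ʳ z zero    F = bracket-zeroʳ z
bracket-∑ʳ z (suc L) F = ≃-trans (bracket-⊕ʳ z (∑ L F) (F L)) (⊕-congʳ ⟦ z , F L ⟧ (bracket-∑ʳ z L F))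

binomialSum : ℕ → ℕ → (ℕ → Poly) → Poly
binomialSum n L T = ∑ L (λ y → scale (fromℕ (n C y)) (T y))

binomialSum-cong : ∀ n L {S T} → (∀ y → y < L → S y ≃ T y) → binomialSum n L S ≃ binomialSum n L T
binomialSum-cong n L S≃T = ∑-cong L (λ y y<L → scale-cong (fromℕ (n C y)) (S≃T y y<L))

binomialSum-⊕ : ∀ n L S T → binomialSum n L (λ y → S y ⊕ T y) ≃ binomialSum n L S ⊕ binomialSum n L T
binomialSum-⊕ n L S T = ≃-trans (∑-cong L (λ y _ → scale-⊕ (fromℕ (n C y)) (S y) (T y))) (∑-⊕ L _ _)

bracket-binomialSumʳ : ∀ z n L T → ⟦ z , binomialSum n L T ⟧ ≃ binomialSum n L (λ y → ⟦ z , T y ⟧)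
bracket-binomialSumʳ z n L T = ≃-trans (bracket-∑ʳ z L _) (∑-cong L (λ y _ → bracket-scaleʳ (fromℕ (n C y)) z (T y)))

binomialSum-top : ∀ n T → binomialSum n (suc n) T ≃ binomialSum n n T ⊕ T n
binomialSum-top n T = ⊕-congˡ (binomialSum n n T) (≃-trans (scale-congʳ (T n) (cong fromℕ (nCn≡1 n))) (scale-1 (T n)))

binomialSum-beyond : ∀ n L T → n < L → binomialSum n L T ≃ binomialSum n (suc n) T
binomialSum-beyond n L T n<L = ≃-trans (≡⇒≃ (cong (λ l → binomialSum n l T) (sym (ℕₚ.m∸n+n≡m n<L))))
  (∑-null-tail (L ∸ suc n) (suc n) _ λ y n<y → ≃-trans (scale-congʳ (T y) (cong fromℕ (k>n⇒nCk≡0 n<y))) (scale-0 (T y)))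

binomialSum-pascal : ∀ m T →
  binomialSum (suc m) (suc m) T ≃ binomialSum m m (λ y → T (suc y)) ⊕ binomialSum m (suc m) T
binomialSum-pascal m T = begin
  binomialSum (suc m) (suc m) T
    ≈⟨ ∑-shift m _ ⟩
  head ⊕ ∑ m (λ y → scale (fromℕ (suc m C suc y)) (T (suc y)))
    ≈⟨ ⊕-congˡ head (∑-cong m (λ y _ → scale-congʳ (T (suc y)) (fromℕ-pascal m y))) ⟩
  head ⊕ ∑ m (λ y → scale (fromℕ (m C y) ℚ.+ fromℕ (m C suc y)) (T (suc y)))
    ≈⟨ ⊕-congˡ head (≃-trans (∑-cong m (λ y _ → scale-+ (fromℕ (m C y)) (fromℕ (m C suc y)) (T (suc y))))
                             (∑-⊕ m _ _)) ⟩
  head ⊕ (shifted ⊕ rest)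
    ≈⟨ by-coeffs (‵ head ⊕ₗ (‵ shifted ⊕ₗ ‵ rest)) (‵ shifted ⊕ₗ (‵ head ⊕ₗ ‵ rest)) (λ w →
         solve 3 (λ a b c → a :+ (b :+ c) := b :+ (a :+ c)) refl (coeff head w) (coeff shifted w) (coeff rest w)) ⟩
  shifted ⊕ (head ⊕ rest)
    ≈⟨ ⊕-congˡ shifted (∑-shift m _) ⟨
  shifted ⊕ binomialSum m (suc m) T
    ∎
  where
  open SetoidReasoning ≃-setoid
  head = scale 1ℚ (T 0)
  shifted = binomialSum m m (λ y → T (suc y))
  rest = ∑ m (λ y → scale (fromℕ (m C suc y)) (T (suc y)))

-- The Ihara bracket of the Φ m = ad_a^m b

Φ : ℕ → Poly
Φ m = iter m ad-a bP

Φ-pair : ℕ → ℕ → Poly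
Φ-pair N y = ⟦ Φ y , Φ (N ∸ y) ⟧

D-Φ : ∀ m q → D (Φ q) (Φ m) ≃ binomialSum m m (Φ-pair (m + q))
D-Φ zero    q = D-b (Φ q)
D-Φ (suc m) q = begin
  D (Φ q) ⟦ aP , Φ m ⟧
    ≈⟨ D-bracket (Φ q) aP (Φ m) ⟩
  ⟦ D (Φ q) aP , Φ m ⟧ ⊕ ⟦ aP , D (Φ q) (Φ m) ⟧
    ≈⟨ ⊕-cong (≃-trans (bracket-congʳ (Φ m) (D-a (Φ q))) (bracket-flip (Φ q) aP (Φ m)))
              (bracket-congˡ aP (D-Φ m q)) ⟩
  ⟦ Φ m , Φ (suc q) ⟧ ⊕ ⟦ aP , binomialSum m m (Φ-pair (m + q)) ⟧
    ≈⟨ ⊕-cong (≡⇒≃ (cong (λ k → ⟦ Φ m , Φ k ⟧) (sym top-index)))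
              (≃-trans (bracket-binomialSumʳ aP m m _) (binomialSum-cong m m ad-a-pair)) ⟩
  T m ⊕ binomialSum m m (λ y → T (suc y) ⊕ T y)
    ≈⟨ ⊕-congˡ (T m) (binomialSum-⊕ m m _ _) ⟩
  T m ⊕ (shifted ⊕ binomialSum m m T)
    ≈⟨ ≃-trans (⊕-comm (T m) _) (⊕-assoc shifted (binomialSum m m T) (T m)) ⟩
  shifted ⊕ (binomialSum m m T ⊕ T m)
    ≈⟨ ⊕-congˡ shifted (binomialSum-top m T) ⟨
  shifted ⊕ binomialSum m (suc m) T
    ≈⟨ binomialSum-pascal m T ⟨
  binomialSum (suc m) (suc m) T
    ∎
  where
  open SetoidReasoning ≃-setoid
  T = Φ-pair (suc m + q)
  shifted = binomialSum m m (λ y → T (suc y))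
  top-index : suc m + q ∸ m ≡ suc q
  top-index = trans (cong (_∸ m) (sym (ℕₚ.+-suc m q))) (ℕₚ.m+n∸m≡n m (suc q))
  ad-a-pair : ∀ y → y < m → ⟦ aP , Φ-pair (m + q) y ⟧ ≃ T (suc y) ⊕ T y
  ad-a-pair y y<m = ≃-trans (bracket-leibniz aP (Φ y) (Φ (m + q ∸ y)))
    (⊕-congˡ (T (suc y)) (≡⇒≃ (cong (λ k → ⟦ Φ y , Φ k ⟧)
      (sym (ℕₚ.+-∸-assoc 1 (ℕₚ.≤-trans (ℕₚ.<⇒≤ y<m) (ℕₚ.m≤m+n m q)))))))

bracket-as-boundary : ∀ m q → let T = Φ-pair (m + q) in
  ⟦ Φ m , Φ q ⟧ ⊕ binomialSum m m T ⊖ binomialSum q q T ≃ binomialSum m (m ⊔ q) T ⊖ binomialSum q (m ⊔ q) T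
bracket-as-boundary m q with ℕₚ.<-cmp m q
... | tri< m<q _ _ = begin
  X ⊕ Sm ⊖ Sq
    ≈⟨ by-coeffs (‵ X ⊕ₗ ‵ Sm ⊖ₗ ‵ Sq) ((‵ Sm ⊕ₗ ‵ X) ⊖ₗ ‵ Sq) (λ w →
         solve 3 (λ x a b → x :+ a :+ m1 :* b := (a :+ x) :+ m1 :* b) refl (coeff X w) (coeff Sm w) (coeff Sq w)) ⟩
  (Sm ⊕ X) ⊖ Sq
    ≈⟨ ⊖-cong (⊕-congˡ Sm (≡⇒≃ (cong (λ k → ⟦ Φ m , Φ k ⟧) (sym (ℕₚ.m+n∸m≡n m q))))) ≃-refl ⟩
  (Sm ⊕ T m) ⊖ Sq
    ≈⟨ ⊖-cong (≃-trans (binomialSum-beyond m q T m<q) (binomialSum-top m T)) ≃-refl ⟨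
  binomialSum m q T ⊖ Sq
    ≈⟨ ≡⇒≃ (cong (λ L → binomialSum m L T ⊖ binomialSum q L T) (ℕₚ.m≤n⇒m⊔n≡n (ℕₚ.<⇒≤ m<q))) ⟨
  binomialSum m (m ⊔ q) T ⊖ binomialSum q (m ⊔ q) T
    ∎
  where
  open SetoidReasoning ≃-setoid
  m1 = :- con 1ℚ
  T = Φ-pair (m + q)
  X = ⟦ Φ m , Φ q ⟧
  Sm = binomialSum m m T
  Sq = binomialSum q q T
... | tri≈ _ refl _ = begin
  ⟦ Φ m , Φ m ⟧ ⊕ Sm ⊖ Sm
    ≈⟨ ⊖-cong (⊕-congʳ Sm (bracket-self (Φ m))) ≃-refl ⟩
  Sm ⊖ Sm
    ≈⟨ ≡⇒≃ (cong (λ L → binomialSum m L T ⊖ binomialSum m L T) (ℕₚ.⊔-idem m)) ⟨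
  binomialSum m (m ⊔ m) T ⊖ binomialSum m (m ⊔ m) T
    ∎
  where
  open SetoidReasoning ≃-setoid
  T = Φ-pair (m + m)
  Sm = binomialSum m m T
... | tri> _ _ q<m = begin
  X ⊕ Sm ⊖ Sq
    ≈⟨ by-coeffs (‵ X ⊕ₗ ‵ Sm ⊖ₗ ‵ Sq) (‵ Sm ⊖ₗ (‵ Sq ⊕ₗ -1ℚ ·ₗ ‵ X)) (λ w →
         solve 3 (λ x a b → x :+ a :+ m1 :* b := a :+ m1 :* (b :+ m1 :* x)) refl (coeff X w) (coeff Sm w) (coeff Sq w)) ⟩
  Sm ⊖ (Sq ⊕ scale -1ℚ X)
    ≈⟨ ⊖-cong ≃-refl (⊕-congˡ Sq (bracket-antisym (Φ q) (Φ m))) ⟨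
  Sm ⊖ (Sq ⊕ ⟦ Φ q , Φ m ⟧)
    ≈⟨ ⊖-cong ≃-refl (⊕-congˡ Sq (≡⇒≃ (cong (λ k → ⟦ Φ q , Φ k ⟧) (sym (ℕₚ.m+n∸n≡m m q))))) ⟩
  Sm ⊖ (Sq ⊕ T q)
    ≈⟨ ⊖-cong ≃-refl (≃-trans (binomialSum-beyond q m T q<m) (binomialSum-top q T)) ⟨
  Sm ⊖ binomialSum q m T
    ≈⟨ ≡⇒≃ (cong (λ L → binomialSum m L T ⊖ binomialSum q L T) (ℕₚ.m≥n⇒m⊔n≡m (ℕₚ.<⇒≤ q<m))) ⟨
  binomialSum m (m ⊔ q) T ⊖ binomialSum q (m ⊔ q) T
    ∎
  where
  open SetoidReasoning ≃-setoid
  m1 = :- con 1ℚ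
  T = Φ-pair (m + q)
  X = ⟦ Φ m , Φ q ⟧
  Sm = binomialSum m m T
  Sq = binomialSum q q T

ihara-Φ : ∀ m q → ihara (Φ m) (Φ q) ≃ ∑ (m ⊔ q) (λ y → scale (fromℕ (m C y) - fromℕ (q C y)) (Φ-pair (m + q) y))
ihara-Φ m q = begin
  ⟦ Φ m , Φ q ⟧ ⊕ D (Φ q) (Φ m) ⊖ D (Φ m) (Φ q)
    ≈⟨ ⊖-cong (⊕-congˡ ⟦ Φ m , Φ q ⟧ (D-Φ m q))
              (≃-trans (D-Φ q m) (≡⇒≃ (cong (λ N → binomialSum q q (Φ-pair N)) (ℕₚ.+-comm q m)))) ⟩
  ⟦ Φ m , Φ q ⟧ ⊕ binomialSum m m T ⊖ binomialSum q q T
    ≈⟨ bracket-as-boundary m q ⟩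
  binomialSum m (m ⊔ q) T ⊖ binomialSum q (m ⊔ q) T
    ≈⟨ ≃-trans (∑-cong (m ⊔ q) (λ y _ → scale-- (fromℕ (m C y)) (fromℕ (q C y)) (T y))) (∑-⊖ (m ⊔ q) _ _) ⟨
  ∑ (m ⊔ q) (λ y → scale (fromℕ (m C y) - fromℕ (q C y)) (T y))
    ∎
  where
  open SetoidReasoning ≃-setoid
  T = Φ-pair (m + q)

¬T⇒≡false : ∀ {b} → ¬ Bool.T b → b ≡ false
¬T⇒≡false {false} _  = refl
¬T⇒≡false {true}  ¬t = contradiction _ ¬t

binomShift-≤ : ∀ M {n k} → k ≤ n → binomShift M n k ≡ fromℕ (M C (n ∸ k))
binomShift-≤ M {n} {k} k≤n =
  cong (λ b → if b then fromℕ (M C (n ∸ k)) else 0ℚ) (Equivalence.to T-≡ (ℕₚ.≤⇒≤ᵇ k≤n))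

binomShift-> : ∀ M {n k} → n < k → binomShift M n k ≡ 0ℚ
binomShift-> M {n} {k} n<k =
  cong (λ b → if b then fromℕ (M C (n ∸ k)) else 0ℚ) (¬T⇒≡false (ℕₚ.<⇒≱ n<k ∘ ℕₚ.≤ᵇ⇒≤ k n))

-- The paper's coefficient C(n+p-1-k, n-k) on [φ k, φ (n+p-k)], for n = m+1,
-- p = q+1, k = x+1, becomes C(m, x) / (m! q!) on [Φ x, Φ (m+q-x)].
binomShift-normalised : ∀ m q x {M N} → m + q ≡ N → M ≡ N ∸ x → x ≤ N →
  binomShift M (suc m) (suc x) ℚ.* (fact⁻¹ x ℚ.* fact⁻¹ (N ∸ x)) ≡ fromℕ (m C x) ℚ.* (fact⁻¹ m ℚ.* fact⁻¹ q)
binomShift-normalised m q x refl refl x≤N = [ within , beyond ]′ (ℕₚ.≤-<-connex x m)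
  where
  open ≡-Reasoning
  n = m + q ∸ x
  F = fact⁻¹ x ℚ.* fact⁻¹ n
  G = fact⁻¹ m ℚ.* fact⁻¹ q
  within : x ≤ m → binomShift n (suc m) (suc x) ℚ.* F ≡ fromℕ (m C x) ℚ.* G
  within x≤m = trans (cong (ℚ._* F) (binomShift-≤ n (s≤s x≤m)))
    (cross-multiply (fromℕ (n C (m ∸ x))) (fromℕ (m C x)) (fromℕ (x !) ℚ.* fromℕ (n !)) (fromℕ (m !) ℚ.* fromℕ (q !))
      F G (factorials-*-fact⁻¹ x n) (factorials-*-fact⁻¹ m q) (begin
        fromℕ (n C (m ∸ x)) ℚ.* (fromℕ (m !) ℚ.* fromℕ (q !))  ≡⟨ fromℕ-*-* (n C (m ∸ x)) (m !) (q !) ⟨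
        fromℕ ((n C (m ∸ x)) ℕ.* (m ! ℕ.* q !))                 ≡⟨ cong fromℕ (binomial-factorial-identity m q x x≤m) ⟩
        fromℕ ((m C x) ℕ.* (x ! ℕ.* n !))                       ≡⟨ fromℕ-*-* (m C x) (x !) (n !) ⟩
        fromℕ (m C x) ℚ.* (fromℕ (x !) ℚ.* fromℕ (n !))         ∎))
  beyond : m < x → binomShift n (suc m) (suc x) ℚ.* F ≡ fromℕ (m C x) ℚ.* G
  beyond m<x = begin
    binomShift n (suc m) (suc x) ℚ.* F  ≡⟨ cong (ℚ._* F) (binomShift-> n (s≤s m<x)) ⟩
    0ℚ ℚ.* F                            ≡⟨ ℚₚ.*-zeroˡ F ⟩
    0ℚ                                  ≡⟨ ℚₚ.*-zeroˡ G ⟨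
    0ℚ ℚ.* G                            ≡⟨ cong (λ c → fromℕ c ℚ.* G) (k>n⇒nCk≡0 m<x) ⟨
    fromℕ (m C x) ℚ.* G                 ∎

coefficient-normalised : ∀ m q y → y ≤ m + q →
  let M = suc m + suc q ∸ 1 ∸ suc y in
  (binomShift M (suc m) (suc y) - binomShift M (suc q) (suc y)) ℚ.* (fact⁻¹ y ℚ.* fact⁻¹ (m + q ∸ y))
  ≡ (fact⁻¹ m ℚ.* fact⁻¹ q) ℚ.* (fromℕ (m C y) - fromℕ (q C y))
coefficient-normalised m q y y≤N = begin
  (B₁ - B₂) ℚ.* F
    ≡⟨ solve 3 (λ b₁ b₂ f → (b₁ :+ (:- b₂)) :* f := b₁ :* f :+ (:- (b₂ :* f))) refl B₁ B₂ F ⟩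
  B₁ ℚ.* F ℚ.+ ℚ.- (B₂ ℚ.* F)
    ≡⟨ cong₂ (λ s t → s ℚ.+ ℚ.- t) (binomShift-normalised m q y refl shifted y≤N)
                                   (binomShift-normalised q m y (ℕₚ.+-comm q m) shifted y≤N) ⟩
  Cm ℚ.* (αm ℚ.* αq) ℚ.+ ℚ.- (Cq ℚ.* (αq ℚ.* αm))
    ≡⟨ solve 4 (λ cm cq am aq → cm :* (am :* aq) :+ (:- (cq :* (aq :* am))) := (am :* aq) :* (cm :+ (:- cq))) refl
         Cm Cq αm αq ⟩
  (αm ℚ.* αq) ℚ.* (Cm - Cq)
    ∎
  where
  open ≡-Reasoning
  B₁ = binomShift (suc m + suc q ∸ 1 ∸ suc y) (suc m) (suc y)
  B₂ = binomShift (suc m + suc q ∸ 1 ∸ suc y) (suc q) (suc y)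
  F = fact⁻¹ y ℚ.* fact⁻¹ (m + q ∸ y)
  Cm = fromℕ (m C y)
  Cq = fromℕ (q C y)
  αm = fact⁻¹ m
  αq = fact⁻¹ q
  shifted : suc m + suc q ∸ 1 ∸ suc y ≡ m + q ∸ y
  shifted = cong (_∸ suc y) (ℕₚ.+-suc m q)

sumFrom1≡∑ : ∀ M t → sumFrom1 M t ≡ ∑ M (λ y → t (suc y))
sumFrom1≡∑ zero    t = refl
sumFrom1≡∑ (suc M) t = cong (_⊕ t (suc M)) (sumFrom1≡∑ M t)

rhs-as-Φ-sum : ∀ m q →
  sumFrom1 (m ⊔ q) (λ k → scale (binomShift (suc m + suc q ∸ 1 ∸ k) (suc m) k - binomShift (suc m + suc q ∸ 1 ∸ k) (suc q) k)
                                ⟦ φ k , φ (suc m + suc q ∸ k) ⟧)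
  ≃ scale (fact⁻¹ m ℚ.* fact⁻¹ q) (∑ (m ⊔ q) (λ y → scale (fromℕ (m C y) - fromℕ (q C y)) (Φ-pair (m + q) y)))
rhs-as-Φ-sum m q = ≃-trans (≡⇒≃ (sumFrom1≡∑ (m ⊔ q) _)) (≃-trans (∑-cong (m ⊔ q) term)
  (∑-scale (m ⊔ q) (fact⁻¹ m ℚ.* fact⁻¹ q) (λ y → scale (fromℕ (m C y) - fromℕ (q C y)) (Φ-pair (m + q) y))))
  where
  N = m + q
  term : ∀ y → y < m ⊔ q →
    scale (binomShift (suc m + suc q ∸ 1 ∸ suc y) (suc m) (suc y) - binomShift (suc m + suc q ∸ 1 ∸ suc y) (suc q) (suc y))
          ⟦ φ (suc y) , φ (suc m + suc q ∸ suc y) ⟧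
    ≃ scale (fact⁻¹ m ℚ.* fact⁻¹ q) (scale (fromℕ (m C y) - fromℕ (q C y)) (Φ-pair N y))
  term y y<M = begin
    scale (B₁ - B₂) ⟦ φ (suc y) , φ (suc m + suc q ∸ suc y) ⟧
      ≈⟨ scale-cong (B₁ - B₂) (bracket-congˡ (φ (suc y)) (≡⇒≃ (cong φ index))) ⟩
    scale (B₁ - B₂) ⟦ scale (fact⁻¹ y) (Φ y) , scale (fact⁻¹ (N ∸ y)) (Φ (N ∸ y)) ⟧
      ≈⟨ ≃-trans (scale-cong (B₁ - B₂) (bracket-scale (fact⁻¹ y) (fact⁻¹ (N ∸ y)) (Φ y) (Φ (N ∸ y))))
                 (scale-scale (B₁ - B₂) (fact⁻¹ y ℚ.* fact⁻¹ (N ∸ y)) (Φ-pair N y)) ⟩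
    scale ((B₁ - B₂) ℚ.* (fact⁻¹ y ℚ.* fact⁻¹ (N ∸ y))) (Φ-pair N y)
      ≈⟨ scale-congʳ (Φ-pair N y) (coefficient-normalised m q y y≤N) ⟩
    scale ((fact⁻¹ m ℚ.* fact⁻¹ q) ℚ.* (fromℕ (m C y) - fromℕ (q C y))) (Φ-pair N y)
      ≈⟨ scale-scale (fact⁻¹ m ℚ.* fact⁻¹ q) (fromℕ (m C y) - fromℕ (q C y)) (Φ-pair N y) ⟨
    scale (fact⁻¹ m ℚ.* fact⁻¹ q) (scale (fromℕ (m C y) - fromℕ (q C y)) (Φ-pair N y)) ∎
    where
    open SetoidReasoning ≃-setoid
    B₁ = binomShift (suc m + suc q ∸ 1 ∸ suc y) (suc m) (suc y)
    B₂ = binomShift (suc m + suc q ∸ 1 ∸ suc y) (suc q) (suc y)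
    y≤N : y ≤ N
    y≤N = ℕₚ.≤-trans (ℕₚ.<⇒≤ y<M) (ℕₚ.m⊔n≤m+n m q)
    index : suc m + suc q ∸ suc y ≡ suc (N ∸ y)
    index = trans (cong (_∸ y) (ℕₚ.+-suc m q)) (ℕₚ.+-∸-assoc 1 y≤N)

mainTheorem2 : ∀ (n p : ℕ) → 1 ≤ n → 1 ≤ p →
    ihara (φ n) (φ p) ≈
      sumFrom1 ((n ∸ 1) ⊔ (p ∸ 1))
        (λ k → scale (binomShift (n + p ∸ 1 ∸ k) n k - binomShift (n + p ∸ 1 ∸ k) p k)
                     ⟦ φ k , φ (n + p ∸ k) ⟧)
mainTheorem2 (suc m) (suc q) (s≤s z≤n) (s≤s z≤n) = coeff-≡ (begin
  ihara (scale (fact⁻¹ m) (Φ m)) (scale (fact⁻¹ q) (Φ q))   ≈⟨ ihara-scale (fact⁻¹ m) (fact⁻¹ q) (Φ m) (Φ q) ⟩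
  scale (fact⁻¹ m ℚ.* fact⁻¹ q) (ihara (Φ m) (Φ q))         ≈⟨ scale-cong (fact⁻¹ m ℚ.* fact⁻¹ q) (ihara-Φ m q) ⟩
  scale (fact⁻¹ m ℚ.* fact⁻¹ q) (∑ (m ⊔ q) _)               ≈⟨ rhs-as-Φ-sum m q ⟨
  sumFrom1 (m ⊔ q) _                                        ∎)
  where open SetoidReasoning ≃-setoid
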